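{- Let $\Gamma=\forall x\forall y\,\phi(x,y)\land\bigwedge_{k=1}^m\forall x\exists y\,\beta_k(x,y)$ be an $\mathbf{FO}^2$ sentence in Scott normal form and $\delta=\max\{m(m+1),2m+1\}$. A configuration $\mathbf{n}$ of $\Gamma$ is satisfiable if and only if there exists a satisfiable configuration $\mathbf{n}'\in\{0,1,\dots,\delta\}^{|U|}$ such that $\mathbf{n}'\preccurlyeq\mathbf{n}$.
   Context: $\Gamma$ is function-free, without equality, $\phi$ is quantifier-free, the $\beta_k$ are binary predicates, and structures have finite domains. A 1-type of $\Gamma$ is a maximally consistent set of literals over the predicates of $\Gamma$ in which every literal involves only the variable $x$; $U=\{\tau_1,\dots,\tau_{|U|}\}$ is the set of all 1-types; an element $e$ realizes $\tau$ if $\tau(e)$ holds. A configuration is a vector $\mathbf{n}=(n_1,\dots,n_{|U|})$ of non-negative integers; it is satisfiable if there is a model of $\Gamma$ over a domain of size $\sum_i n_i$ in which exactly $n_i$ elements realize $\tau_i$ for each $i$. Write $\mathbf{n}'\preccurlyeq\mathbf{n}$ if for all $i$: $n_i\ge n_i'$ when $n_i'>0$, and $n_i=n_i'$ when $n_i'=0$. -}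

module Defs where

open import Data.Nat using (ℕ; zero; suc; _+_; _*_; _⊔_; _≤_; _>_)
open import Data.Bool using (Bool; true; false; not; _∧_; _∨_)
open import Data.Bool.Properties using () renaming (_≟_ to _≟B_)
open import Data.Fin using (Fin)
open import Data.Vec using (Vec; []; _∷_; tabulate)
import Data.Vec.Properties as VP
open import Data.List using (List; []; _∷_; map; _++_; filter; length; allFin)
open import Data.Nat.ListAction using (sum)
open import Data.Product using (Σ; ∃; _×_; _,_; proj₁; proj₂)
open import Relation.Binary.PropositionalEquality using (_≡_; refl)
open import Relation.Binary.Definitions using (DecidableEquality)
open import Relation.Nullary using (yes; no)
open import Relation.Nullary.Decidable using (_×-dec_)

data Var : Set where
  vx vy : Var

data QF (u b : ℕ) : Set where
  unary  : Fin u → Var → QF u b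
  binary : Fin b → Var → Var → QF u b
  ¬'_    : QF u b → QF u b
  _∧'_   : QF u b → QF u b → QF u b
  _∨'_   : QF u b → QF u b → QF u b

record Structure (u b N : ℕ) : Set where
  field
    unI : Fin u → Fin N → Bool
    biI : Fin b → Fin N → Fin N → Bool
open Structure public

eval : ∀ {u b N} → Structure u b N → QF u b → Fin N → Fin N → Bool
eval {u} {b} {N} 𝔄 φ d e = go φ
  where
  val : Var → Fin N
  val vx = d
  val vy = e
  go : QF u b → Bool
  go (unary i v)    = unI 𝔄 i (val v)
  go (binary j v w) = biI 𝔄 j (val v) (val w)
  go (¬' ψ)         = not (go ψ)
  go (ψ ∧' χ)       = go ψ ∧ go χ
  go (ψ ∨' χ)       = go ψ ∨ go χ

-- Scott normal form  Γ = ∀x∀y φ(x,y) ∧ ⋀_{k=1}^m ∀x∃y β_k(x,y),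
-- the β_k being binary predicate symbols of the signature.
record SNF (u b m : ℕ) : Set where
  field
    φ : QF u b
    β : Fin m → Fin b
open SNF public

_⊨_ : ∀ {u b m N} → Structure u b N → SNF u b m → Set
𝔄 ⊨ Γ = (∀ d e → eval 𝔄 (φ Γ) d e ≡ true)
      × (∀ k d → ∃ λ e → biI 𝔄 (β Γ k) d e ≡ true)

-- 1-types: a maximally consistent set of literals in the single variable x,
-- i.e. a truth value for every P_i(x) and every R_j(x,x).
OneType : ℕ → ℕ → Set
OneType u b = Vec Bool u × Vec Bool b

_≟τ_ : ∀ {u b} → DecidableEquality (OneType u b)
(p , r) ≟τ (p' , r') with VP.≡-dec _≟B_ p p' | VP.≡-dec _≟B_ r r'
... | yes refl | yes refl = yes refl
... | no ne    | _        = no λ { refl → ne refl }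
... | yes _    | no ne    = no λ { refl → ne refl }

typeOf : ∀ {u b N} → Structure u b N → Fin N → OneType u b
typeOf 𝔄 d = tabulate (λ i → unI 𝔄 i d) , tabulate (λ j → biI 𝔄 j d d)

allBoolVecs : ∀ k → List (Vec Bool k)
allBoolVecs zero    = [] ∷ []
allBoolVecs (suc k) = map (true ∷_) (allBoolVecs k) ++ map (false ∷_) (allBoolVecs k)

allTypes : ∀ u b → List (OneType u b)
allTypes u b = Data.List.concatMap (λ p → map (p ,_) (allBoolVecs b)) (allBoolVecs u)
  where import Data.List

countType : ∀ {u b N} → Structure u b N → OneType u b → ℕ
countType {N = N} 𝔄 τ = length (filter (λ d → typeOf 𝔄 d ≟τ τ) (allFin N))

Config : ℕ → ℕ → Set
Config u b = OneType u b → ℕ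

size : ∀ {u b} → Config u b → ℕ
size {u} {b} n = sum (map n (allTypes u b))

Satisfiable : ∀ {u b m} → SNF u b m → Config u b → Set
Satisfiable {u} {b} Γ n =
  Σ (Structure u b (size n)) λ 𝔄 → (𝔄 ⊨ Γ) × (∀ τ → countType 𝔄 τ ≡ n τ)

_≼_ : ∀ {u b} → Config u b → Config u b → Set
n' ≼ n = ∀ τ → (n' τ > 0 → n τ ≥' n' τ) × (n' τ ≡ 0 → n τ ≡ n' τ)
  where
  _≥'_ : ℕ → ℕ → Set
  a ≥' c = c ≤ a

δ : ℕ → ℕ
δ m = (m * (m + 1)) ⊔ (2 * m + 1)

Bounded : ∀ {u b} → ℕ → Config u b → Set
Bounded k n = ∀ τ → n τ ≤ k

module Submission where

-- Suppose every element x of a new domain is told, for each partner y, which element play x y of a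
-- model A of Γ to imitate, play x y always having the 1-type assigned to x, and suppose every x has,
-- for each k, a partner y such that β_k holds between play x y and play y x in A. Reading each pair
-- (x, y) as the pair (play x y, play y x) of A then gives a model of Γ with the prescribed counts of
-- 1-types, because φ holds for all pairs of A. Enlarging a configuration is immediate: every new
-- element imitates an old one of its type. For shrinking, a type realized more than D ≥ δ m times
-- keeps only D clones of one representative p. Clone i of p imitates its profile: p itself, except
-- that clone m + (j m + k) imitates f_k (f_j p) when that has the type of p, f_k being the β_k-witness
-- function of A; m (m + 1) ≤ D makes room for these. The k-th witness of a kept element a is the clone
-- target p a k, and that of clone i' of q is clone i' + k + 1 (mod D). Since 2 m + 1 ≤ D, no clone
-- ever has to serve as a witness of a clone that serves as its own witness, so the demands never clash.

open import Defs
open import Data.Nat using (ℕ; zero; suc; _+_; _*_; _∸_; _⊓_; _≤_; _<_; _>_; z≤n; z<s; _<?_; _≤?_; >-nonZero)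
open import Data.Nat.Properties
open import Data.Nat.ListAction using (sum)
open import Data.Nat.DivMod using (_mod_; _%_; m<n⇒m%n≡m)
open import Data.Bool using (Bool; true; false; not; _∧_; _∨_; if_then_else_)
import Data.Bool.Properties as Bool
open import Data.Fin using (Fin; zero; suc; toℕ; fromℕ<; cast; combine; _↑ˡ_; _↑ʳ_; splitAt)
import Data.Fin.Properties as Fin
open import Data.Vec using (Vec; []; _∷_; lookup)
import Data.Vec.Properties as Vec
open import Data.List using (List; []; _∷_; map; _++_; filter; length; concatMap; tabulate; allFin)
import Data.List as List
open import Data.List.Relation.Unary.Any using (here; there; index)
import Data.List.Relation.Unary.Any.Properties as Any
open import Data.List.Membership.Propositional using (_∈_)
import Data.List.Membership.Propositional.Properties as ∈
open import Data.Product using (Σ; ∃; _×_; _,_; proj₁; proj₂)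
open import Data.Empty using (⊥)
open import Data.Sum using (_⊎_; inj₁; inj₂; [_,_]′)
open import Function using (_∘_)
open import Function.Bundles using (_⇔_; mk⇔)
open import Relation.Binary.PropositionalEquality
open import Relation.Binary.Definitions using (DecidableEquality)
open import Relation.Nullary using (Dec; yes; no; does; ¬_; contradiction)
open import Relation.Nullary.Decidable using (dec-true; dec-false; _×-dec_)
open import Relation.Unary using (Decidable)

count : ∀ {N} → (Fin N → Bool) → ℕ
count {zero}  p = 0
count {suc N} p = (if p zero then 1 else 0) + count (p ∘ suc)

length-filter-tabulate : ∀ {a} {A : Set a} {N} {P : A → Set} (P? : Decidable P) (g : Fin N → A) →
  length (filter P? (tabulate g)) ≡ count (does ∘ P? ∘ g)
length-filter-tabulate {N = zero}  P? g = refl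
length-filter-tabulate {N = suc N} P? g with does (P? (g zero))
... | true  = cong suc (length-filter-tabulate P? (g ∘ suc))
... | false = length-filter-tabulate P? (g ∘ suc)

count-cong : ∀ {N} {p q : Fin N → Bool} → (∀ i → p i ≡ q i) → count p ≡ count q
count-cong {zero}  e = refl
count-cong {suc N} e rewrite e zero = cong (_ +_) (count-cong (e ∘ suc))

count-↑ : ∀ a {b} (p : Fin (a + b) → Bool) →
  count p ≡ count (λ i → p (i ↑ˡ b)) + count (λ i → p (a ↑ʳ i))
count-↑ zero    p = refl
count-↑ (suc a) p = trans (cong (head +_) (count-↑ a (p ∘ suc))) (sym (+-assoc head _ _))
  where head = if p zero then 1 else 0

count-const : ∀ N (x : Bool) → count {N} (λ _ → x) ≡ (if x then N else 0)
count-const zero    true  = refl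
count-const zero    false = refl
count-const (suc N) true  = cong suc (count-const N true)
count-const (suc N) false = count-const N false

module _ {A : Set} (_≟_ : DecidableEquality A) where

  multiplicity : A → List A → ℕ
  multiplicity x []       = 0
  multiplicity x (y ∷ ys) = (if does (y ≟ x) then 1 else 0) + multiplicity x ys

  multiplicity-++ : ∀ x xs ys → multiplicity x (xs ++ ys) ≡ multiplicity x xs + multiplicity x ys
  multiplicity-++ x []       ys = refl
  multiplicity-++ x (z ∷ xs) ys =
    trans (cong (_ +_) (multiplicity-++ x xs ys)) (sym (+-assoc (if does (z ≟ x) then 1 else 0) _ _))

  multiplicity≢0⇒∈ : ∀ {x} xs → ¬ multiplicity x xs ≡ 0 → x ∈ xs
  multiplicity≢0⇒∈ [] m≢0 = contradiction refl m≢0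
  multiplicity≢0⇒∈ {x} (y ∷ ys) m≢0 with y ≟ x
  ... | yes refl = here refl
  ... | no _     = there (multiplicity≢0⇒∈ ys m≢0)

module _ {A B : Set} (_≟ᴮ_ : DecidableEquality B) where

  multiplicity-map-∉ : (f : A → B) → ∀ y → (∀ a → ¬ f a ≡ y) →
    ∀ xs → multiplicity _≟ᴮ_ y (map f xs) ≡ 0
  multiplicity-map-∉ f y ∉ []       = refl
  multiplicity-map-∉ f y ∉ (a ∷ xs) rewrite dec-false (f a ≟ᴮ y) (∉ a) = multiplicity-map-∉ f y ∉ xs

module _ {A B : Set} (_≟ᴬ_ : DecidableEquality A) (_≟ᴮ_ : DecidableEquality B) where

  multiplicity-map-injective : (f : A → B) → (∀ {a a'} → f a ≡ f a' → a ≡ a') →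
    ∀ x xs → multiplicity _≟ᴮ_ (f x) (map f xs) ≡ multiplicity _≟ᴬ_ x xs
  multiplicity-map-injective f inj x []       = refl
  multiplicity-map-injective f inj x (y ∷ xs) with y ≟ᴬ x
  ... | yes y≡x rewrite dec-true  (f y ≟ᴮ f x) (cong f y≡x) = cong suc (multiplicity-map-injective f inj x xs)
  ... | no  y≢x rewrite dec-false (f y ≟ᴮ f x) (y≢x ∘ inj)  = multiplicity-map-injective f inj x xs

  multiplicity-concatMap : (g : A → List B) → ∀ x y →
    (∀ a → multiplicity _≟ᴮ_ y (g a) ≡ (if does (a ≟ᴬ x) then 1 else 0)) →
    ∀ xs → multiplicity _≟ᴮ_ y (concatMap g xs) ≡ multiplicity _≟ᴬ_ x xs
  multiplicity-concatMap g x y hg []       = refl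
  multiplicity-concatMap g x y hg (a ∷ xs) =
    trans (multiplicity-++ _≟ᴮ_ y (g a) (concatMap g xs)) (cong₂ _+_ (hg a) (multiplicity-concatMap g x y hg xs))

_≟ᵛ_ : ∀ {k} → DecidableEquality (Vec Bool k)
_≟ᵛ_ = Vec.≡-dec Bool._≟_

multiplicity-map-∷ : ∀ {k} (x y : Bool) (v : Vec Bool k) vs →
  multiplicity _≟ᵛ_ (x ∷ v) (map (y ∷_) vs) ≡ (if does (y Bool.≟ x) then multiplicity _≟ᵛ_ v vs else 0)
multiplicity-map-∷ x y v vs with y Bool.≟ x
... | yes refl = multiplicity-map-injective _≟ᵛ_ _≟ᵛ_ _ Vec.∷-injectiveʳ v vs
... | no  y≢x  = multiplicity-map-∉ _≟ᵛ_ _ _ (λ _ → y≢x ∘ Vec.∷-injectiveˡ) vs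

multiplicity-allBoolVecs : ∀ k (v : Vec Bool k) → multiplicity _≟ᵛ_ v (allBoolVecs k) ≡ 1
multiplicity-allBoolVecs zero    []      = refl
multiplicity-allBoolVecs (suc k) (x ∷ v) = begin
    multiplicity _≟ᵛ_ (x ∷ v) (map (true ∷_) vs ++ map (false ∷_) vs)
  ≡⟨ multiplicity-++ _≟ᵛ_ _ (map (true ∷_) vs) _ ⟩
    multiplicity _≟ᵛ_ (x ∷ v) (map (true ∷_) vs) + multiplicity _≟ᵛ_ (x ∷ v) (map (false ∷_) vs)
  ≡⟨ cong₂ _+_ (multiplicity-map-∷ x true v vs) (multiplicity-map-∷ x false v vs) ⟩
    (if does (true Bool.≟ x) then _ else 0) + (if does (false Bool.≟ x) then _ else 0)
  ≡⟨ exactly-one x ⟩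
    1 ∎
  where
  open ≡-Reasoning
  vs = allBoolVecs k
  exactly-one : ∀ x → (if does (true Bool.≟ x) then multiplicity _≟ᵛ_ v vs else 0)
                    + (if does (false Bool.≟ x) then multiplicity _≟ᵛ_ v vs else 0) ≡ 1
  exactly-one true  = trans (+-identityʳ _) (multiplicity-allBoolVecs k v)
  exactly-one false = multiplicity-allBoolVecs k v

multiplicity-allTypes : ∀ {u b} (τ : OneType u b) → multiplicity _≟τ_ τ (allTypes u b) ≡ 1
multiplicity-allTypes {u} {b} (p , r) =
  trans (multiplicity-concatMap _≟ᵛ_ _≟τ_ (λ p' → map (p' ,_) (allBoolVecs b)) p (p , r) row (allBoolVecs u))
        (multiplicity-allBoolVecs u p)
  where
  row : ∀ p' → multiplicity _≟τ_ (p , r) (map (p' ,_) (allBoolVecs b)) ≡ (if does (p' ≟ᵛ p) then 1 else 0)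
  row p' with p' ≟ᵛ p
  ... | yes refl = trans (multiplicity-map-injective _≟ᵛ_ _≟τ_ (p ,_) (λ { refl → refl }) r (allBoolVecs b))
                         (multiplicity-allBoolVecs b r)
  ... | no  p'≢p = multiplicity-map-∉ _≟τ_ (p' ,_) (p , r) (λ _ → p'≢p ∘ cong proj₁) (allBoolVecs b)

∈-allTypes : ∀ {u b} (τ : OneType u b) → τ ∈ allTypes u b
∈-allTypes τ = multiplicity≢0⇒∈ _≟τ_ _ (λ m≡0 → 0≢1+n (trans (sym m≡0) (multiplicity-allTypes τ)))

module FinSum {T : Set} (_≟_ : DecidableEquality T) (c : T → ℕ) where

  decode : (xs : List T) → Fin (sum (map c xs)) → Σ T (Fin ∘ c)
  decode (τ ∷ xs) x = [ (τ ,_) , decode xs ]′ (splitAt (c τ) x)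

  encode : (xs : List T) {τ : T} → τ ∈ xs → Fin (c τ) → Fin (sum (map c xs))
  encode (_ ∷ xs) (here refl) i = i ↑ˡ _
  encode (τ ∷ xs) (there τ∈) i = c τ ↑ʳ encode xs τ∈ i

  decode-encode : (xs : List T) {τ : T} (τ∈ : τ ∈ xs) (i : Fin (c τ)) →
    decode xs (encode xs τ∈ i) ≡ (τ , i)
  decode-encode (τ ∷ xs) (here refl) i rewrite Fin.splitAt-↑ˡ (c τ) i (sum (map c xs))            = refl
  decode-encode (τ ∷ xs) (there τ∈) i rewrite Fin.splitAt-↑ʳ (c τ) (sum (map c xs)) (encode xs τ∈ i) =
    decode-encode xs τ∈ i

  count-decode : (xs : List T) (τ : T) →
    count (λ x → does (proj₁ (decode xs x) ≟ τ)) ≡ c τ * multiplicity _≟_ τ xs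
  count-decode []       τ = sym (*-zeroʳ (c τ))
  count-decode (σ ∷ xs) τ = begin
      count (hit ∘ decode (σ ∷ xs))
    ≡⟨ count-↑ (c σ) _ ⟩
      count (hit ∘ decode (σ ∷ xs) ∘ (_↑ˡ rest)) + count (hit ∘ decode (σ ∷ xs) ∘ (c σ ↑ʳ_))
    ≡⟨ cong₂ _+_ (count-cong (λ i → cong (hit ∘ [ (σ ,_) , decode xs ]′) (Fin.splitAt-↑ˡ (c σ) i rest)))
                 (count-cong (λ i → cong (hit ∘ [ (σ ,_) , decode xs ]′) (Fin.splitAt-↑ʳ (c σ) rest i))) ⟩
      count {c σ} (λ _ → does (σ ≟ τ)) + count (hit ∘ decode xs)
    ≡⟨ cong₂ _+_ (count-const (c σ) (does (σ ≟ τ))) (count-decode xs τ) ⟩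
      (if does (σ ≟ τ) then c σ else 0) + c τ * multiplicity _≟_ τ xs
    ≡⟨ head (σ ≟ τ) ⟩
      c τ * multiplicity _≟_ τ (σ ∷ xs) ∎
    where
    open ≡-Reasoning
    rest = sum (map c xs)
    hit : Σ T (Fin ∘ c) → Bool
    hit = does ∘ (_≟ τ) ∘ proj₁
    head : (d : Dec (σ ≡ τ)) → (if does d then c σ else 0) + c τ * multiplicity _≟_ τ xs
                              ≡ c τ * ((if does d then 1 else 0) + multiplicity _≟_ τ xs)
    head (yes refl) = sym (*-suc (c τ) _)
    head (no _)     = refl

module _ {u b N} (A : Structure u b N) {a a' : Fin N} (same : typeOf A a ≡ typeOf A a') where

  typeOf-unI : ∀ i → unI A i a ≡ unI A i a'
  typeOf-unI i = begin
    unI A i a                          ≡⟨ Vec.lookup∘tabulate _ i ⟨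
    lookup (proj₁ (typeOf A a)) i      ≡⟨ cong (λ τ → lookup (proj₁ τ) i) same ⟩
    lookup (proj₁ (typeOf A a')) i     ≡⟨ Vec.lookup∘tabulate _ i ⟩
    unI A i a'                         ∎
    where open ≡-Reasoning

  typeOf-biI-diagonal : ∀ j → biI A j a a ≡ biI A j a' a'
  typeOf-biI-diagonal j = begin
    biI A j a a                        ≡⟨ Vec.lookup∘tabulate _ j ⟨
    lookup (proj₂ (typeOf A a)) j      ≡⟨ cong (λ τ → lookup (proj₂ τ) j) same ⟩
    lookup (proj₂ (typeOf A a')) j     ≡⟨ Vec.lookup∘tabulate _ j ⟩
    biI A j a' a'                      ∎
    where open ≡-Reasoning

module ElementsOfType {u b N} (A : Structure u b N) where

  elementsOf : OneType u b → List (Fin N)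
  elementsOf τ = filter (λ d → typeOf A d ≟τ τ) (allFin N)

  element : ∀ τ → Fin (countType A τ) → Fin N
  element τ = List.lookup (elementsOf τ)

  typeOf-element : ∀ τ j → typeOf A (element τ j) ≡ τ
  typeOf-element τ j = proj₂ (∈.∈-filter⁻ (λ d → typeOf A d ≟τ τ) {xs = allFin N} (∈.∈-lookup j))

  private
    listed : ∀ a → a ∈ elementsOf (typeOf A a)
    listed a = ∈.∈-filter⁺ (λ d → typeOf A d ≟τ typeOf A a) (∈.∈-allFin a) refl

  indexOf : ∀ a → Fin (countType A (typeOf A a))
  indexOf a = index (listed a)

  element-indexOf : ∀ a → element (typeOf A a) (indexOf a) ≡ a
  element-indexOf a = sym (Any.lookup-index (listed a))

module Cells {u b} (c : Config u b) where
  open FinSum _≟τ_ c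

  cell : Fin (size c) → Σ (OneType u b) (Fin ∘ c)
  cell = decode (allTypes u b)

  typeAt : Fin (size c) → OneType u b
  typeAt = proj₁ ∘ cell

  copy : ∀ τ → Fin (c τ) → Fin (size c)
  copy τ = encode (allTypes u b) (∈-allTypes τ)

  cell-copy : ∀ τ i → cell (copy τ i) ≡ (τ , i)
  cell-copy τ = decode-encode (allTypes u b) (∈-allTypes τ)

  count-typeAt : ∀ τ → count (λ x → does (typeAt x ≟τ τ)) ≡ c τ
  count-typeAt τ = begin
    count (λ x → does (typeAt x ≟τ τ))     ≡⟨ count-decode (allTypes u b) τ ⟩
    c τ * multiplicity _≟τ_ τ (allTypes u b) ≡⟨ cong (c τ *_) (multiplicity-allTypes τ) ⟩
    c τ * 1                                ≡⟨ *-identityʳ (c τ) ⟩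
    c τ                                    ∎
    where open ≡-Reasoning

module _ {u b m} (Γ : SNF u b m) (c : Config u b) where
  open Cells c

  record Simulation {N} (A : Structure u b N) : Set where
    field
      play        : Fin (size c) → Fin (size c) → Fin N
      typeOf-play : ∀ x y → typeOf A (play x y) ≡ typeAt x
      witness     : ∀ k x → ∃ λ y → biI A (β Γ k) (play x y) (play y x) ≡ true

  module _ {N} {A : Structure u b N} (sim : Simulation A) where
    open Simulation sim

    pullback : Structure u b (size c)
    pullback = record { unI = λ i x → unI A i (play x x) ; biI = λ j x y → biI A j (play x y) (play y x) }

    -- The literals of x alone, P(x) and R(x,x), are read off play x x; they agree with those of
    -- play x y because both have the type assigned to x.
    private
      same-type : ∀ x y → typeOf A (play x x) ≡ typeOf A (play x y)
      same-type x y = trans (typeOf-play x x) (sym (typeOf-play x y))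

    eval-pullback : ∀ ψ x y → eval pullback ψ x y ≡ eval A ψ (play x y) (play y x)
    eval-pullback (unary i vx)     x y = typeOf-unI A (same-type x y) i
    eval-pullback (unary i vy)     x y = typeOf-unI A (same-type y x) i
    eval-pullback (binary j vx vx) x y = typeOf-biI-diagonal A (same-type x y) j
    eval-pullback (binary j vx vy) x y = refl
    eval-pullback (binary j vy vx) x y = refl
    eval-pullback (binary j vy vy) x y = typeOf-biI-diagonal A (same-type y x) j
    eval-pullback (¬' ψ)           x y = cong not (eval-pullback ψ x y)
    eval-pullback (ψ ∧' χ)         x y = cong₂ _∧_ (eval-pullback ψ x y) (eval-pullback χ x y)
    eval-pullback (ψ ∨' χ)         x y = cong₂ _∨_ (eval-pullback ψ x y) (eval-pullback χ x y)

    countType-pullback : ∀ τ → countType pullback τ ≡ c τ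
    countType-pullback τ = begin
      countType pullback τ
        ≡⟨ length-filter-tabulate (λ x → typeOf pullback x ≟τ τ) (λ x → x) ⟩
      count (λ x → does (typeOf pullback x ≟τ τ))
        ≡⟨ count-cong (λ x → cong (λ σ → does (σ ≟τ τ)) (typeOf-play x x)) ⟩
      count (λ x → does (typeAt x ≟τ τ))
        ≡⟨ count-typeAt τ ⟩
      c τ ∎
      where open ≡-Reasoning

    simulation⇒satisfiable : (∀ d e → eval A (φ Γ) d e ≡ true) → Satisfiable Γ c
    simulation⇒satisfiable φ-holds =
      pullback , ((λ x y → trans (eval-pullback (φ Γ) x y) (φ-holds _ _)) , witness) , countType-pullback

≼⇒≤ : ∀ {u b} {n' n : Config u b} → n' ≼ n → ∀ τ → n' τ ≤ n τ
≼⇒≤ {n' = n'} n'≼n τ with n' τ ≟ 0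
... | yes n'τ≡0 = subst (_≤ _) (sym n'τ≡0) z≤n
... | no  n'τ≢0 = proj₁ (n'≼n τ) (n≢0⇒n>0 n'τ≢0)

module Cloning {u b m} (Γ : SNF u b m) {n' n : Config u b} (n'≼n : n' ≼ n)
               (A : Structure u b (size n')) (A⊨Γ : A ⊨ Γ) (counts : ∀ τ → countType A τ ≡ n' τ) where
  open ElementsOfType A
  open Cells n

  countType>0 : ∀ τ → Fin (n τ) → countType A τ > 0
  countType>0 τ i with n' τ ≟ 0
  ... | yes n'τ≡0 = contradiction (subst Fin (trans (proj₂ (n'≼n τ) n'τ≡0) n'τ≡0) i) Fin.¬Fin0
  ... | no  n'τ≢0 = subst (_> 0) (sym (counts τ)) (n≢0⇒n>0 n'τ≢0)

  clone : ∀ τ → Fin (n τ) → Fin (size n')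
  clone τ i = element τ (_mod_ (toℕ i) (countType A τ) {{>-nonZero (countType>0 τ i)}})

  clone-element : ∀ τ (i : Fin (n τ)) (j : Fin (countType A τ)) → toℕ i ≡ toℕ j →
    clone τ i ≡ element τ j
  clone-element τ i j i≡j = cong (element τ) (Fin.toℕ-injective (begin
    toℕ (toℕ i mod countType A τ)  ≡⟨ Fin.toℕ-fromℕ< _ ⟩
    toℕ i % countType A τ          ≡⟨ m<n⇒m%n≡m (subst (_< countType A τ) (sym i≡j) (Fin.toℕ<n j)) ⟩
    toℕ i                          ≡⟨ i≡j ⟩
    toℕ j                          ∎))
    where
    open ≡-Reasoning
    instance _ = >-nonZero (countType>0 τ i)

  original : Fin (size n) → Fin (size n')
  original x = clone (typeAt x) (proj₂ (cell x))

  original-surjective : ∀ a → ∃ λ x → original x ≡ a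
  original-surjective a = copy σ i , (begin
    original (copy σ i)      ≡⟨ cong (λ (τ , i) → clone τ i) (cell-copy σ i) ⟩
    clone σ i                ≡⟨ clone-element σ i (indexOf a) (Fin.toℕ-fromℕ< j<nσ) ⟩
    element σ (indexOf a)    ≡⟨ element-indexOf a ⟩
    a                        ∎)
    where
    open ≡-Reasoning
    σ = typeOf A a
    j<nσ : toℕ (indexOf a) < n σ
    j<nσ = <-≤-trans (subst (toℕ (indexOf a) <_) (counts σ) (Fin.toℕ<n (indexOf a))) (≼⇒≤ n'≼n σ)
    i = fromℕ< j<nσ

  simulation : Simulation Γ n A
  simulation = record
    { play        = λ x _ → original x
    ; typeOf-play = λ x _ → typeOf-element _ _
    ; witness     = witness
    }
    where
    witness : ∀ k x → ∃ λ y → biI A (β Γ k) (original x) (original y) ≡ true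
    witness k x =
      let w , β-holds = proj₂ A⊨Γ k (original x)
          y , y↦w     = original-surjective w
      in y , subst (λ z → biI A (β Γ k) (original x) z ≡ true) (sym y↦w) β-holds

cloning : ∀ {u b m} (Γ : SNF u b m) {n' n : Config u b} → n' ≼ n → Satisfiable Γ n' → Satisfiable Γ n
cloning Γ n'≼n (A , A⊨Γ , counts) =
  simulation⇒satisfiable Γ _ (Cloning.simulation Γ n'≼n A A⊨Γ counts) (proj₁ A⊨Γ)

module CyclicShift (D : ℕ) where

  infixl 6 _⊕_

  -- (i + s) mod D, provided i < D and s ≤ D.
  _⊕_ : ℕ → ℕ → ℕ
  i ⊕ s with i + s <? D
  ... | yes _ = i + s
  ... | no  _ = i + s ∸ D

  ⊕-< : ∀ {i s} → i < D → s ≤ D → i ⊕ s < D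
  ⊕-< {i} {s} i<D s≤D with i + s <? D
  ... | yes i+s<D = i+s<D
  ... | no  i+s≮D = +-cancelʳ-< D (i + s ∸ D) D
                      (subst (_< D + D) (sym (m∸n+n≡m (≮⇒≥ i+s≮D))) (+-mono-<-≤ i<D s≤D))

  private
    Shifted : ℕ → ℕ → ℕ → Set
    Shifted i s j = (i + s ≡ j) ⊎ (i + s ≡ j + D)

    shifted : ∀ i s {j} → j ≡ i ⊕ s → Shifted i s j
    shifted i s refl with i + s <? D
    ... | yes _     = inj₁ refl
    ... | no  i+s≮D = inj₂ (sym (m∸n+n≡m (≮⇒≥ i+s≮D)))

    wrap-difference : ∀ {i s s' t} → i + s ≡ t → i + s' ≡ t + D → s' ≡ s + D
    wrap-difference {i} {s} {s'} {t} e e' = +-cancelˡ-≡ i _ _ (begin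
      i + s'        ≡⟨ e' ⟩
      t + D         ≡⟨ cong (_+ D) e ⟨
      i + s + D     ≡⟨ +-assoc i s D ⟩
      i + (s + D)   ∎)
      where open ≡-Reasoning

    full-turn : ∀ {j j' t t'} → j + t ≡ j' → j' + t' ≡ j + D → t + t' ≡ D
    full-turn {j} {j'} {t} {t'} e e' = +-cancelˡ-≡ j _ _ (trans (sym (+-assoc j t t')) (trans (cong (_+ t') e) e'))

  ⊕-cancelˡ : ∀ i {s s'} → s < D → s' < D → i ⊕ s ≡ i ⊕ s' → s ≡ s'
  ⊕-cancelˡ i {s} {s'} s<D s'<D eq with shifted i s refl | shifted i s' eq
  ... | inj₁ e | inj₁ e' = +-cancelˡ-≡ i _ _ (trans e (sym e'))
  ... | inj₂ e | inj₂ e' = +-cancelˡ-≡ i _ _ (trans e (sym e'))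
  ... | inj₁ e | inj₂ e' = contradiction (subst (_< D) (wrap-difference e e') s'<D) (m+n≮n s D)
  ... | inj₂ e | inj₁ e' = contradiction (subst (_< D) (wrap-difference e' e) s<D) (m+n≮n s' D)

  ⊕-no-round-trip : ∀ {i i' s s'} → s > 0 → s' > 0 → s + s' < D → i' ≡ i ⊕ s → i ≡ i' ⊕ s' → ⊥
  ⊕-no-round-trip {i} {i'} {s} {s'} s>0 s'>0 s+s'<D i'≡ i≡ with shifted i s i'≡ | shifted i' s' i≡
  ... | inj₁ e | inj₁ e' = <-asym (subst (i <_) e (m<m+n i s>0)) (subst (i' <_) e' (m<m+n i' s'>0))
  ... | inj₂ e | inj₂ e' = <-asym (unwrap e' s'<D) (unwrap e s<D)
    where
    unwrap : ∀ {j j' t} → j + t ≡ j' + D → t < D → j' < j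
    unwrap {j} {j'} e t<D = +-cancelʳ-< D j' j (subst (_< j + D) e (+-monoʳ-< j t<D))
    s<D  = ≤-<-trans (m≤m+n s s') s+s'<D
    s'<D = ≤-<-trans (m≤n+m s' s) s+s'<D
  ... | inj₁ e | inj₂ e' = <-irrefl (full-turn e e') s+s'<D
  ... | inj₂ e | inj₁ e' = <-irrefl (trans (+-comm s s') (full-turn e' e)) s+s'<D

m+m<δ : ∀ m → m + m < δ m
m+m<δ m = subst (_≤ δ m) (trans (+-comm (2 * m) 1) (cong (λ k → suc (m + k)) (+-identityʳ m)))
                          (m≤n⊔m (m * (m + 1)) (2 * m + 1))

m+m*m≤δ : ∀ m → m + m * m ≤ δ m
m+m*m≤δ m = subst (_≤ δ m) (trans (cong (m *_) (+-comm m 1)) (*-suc m m)) (m≤m⊔n (m * (m + 1)) (2 * m + 1))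

δ>0 : ∀ m → δ m > 0
δ>0 m = ≤-<-trans z≤n (m+m<δ m)

module Shrinking {u b m} (Γ : SNF u b m) {n : Config u b} (D : ℕ) (δ≤D : δ m ≤ D)
                 (A : Structure u b (size n)) (A⊨Γ : A ⊨ Γ) (counts : ∀ τ → countType A τ ≡ n τ) where

  N : ℕ
  N = size n

  n' : Config u b
  n' τ = n τ ⊓ D

  open ElementsOfType A
  open Cells n'
  open CyclicShift D

  2m<D : m + m < D
  2m<D = <-≤-trans (m+m<δ m) δ≤D

  m+m*m≤D : m + m * m ≤ D
  m+m*m≤D = ≤-trans (m+m*m≤δ m) δ≤D

  m<D : m < D
  m<D = ≤-<-trans (m≤m+n m m) 2m<D

  step<D : (k : Fin m) → suc (toℕ k) < D
  step<D k = ≤-<-trans (Fin.toℕ<n k) m<D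

  witness : Fin m → Fin N → Fin N
  witness k a = proj₁ (proj₂ A⊨Γ k a)

  witness-β : ∀ k a → biI A (β Γ k) a (witness k a) ≡ true
  witness-β k a = proj₂ (proj₂ A⊨Γ k a)

  slot : Fin m → Fin m → ℕ
  slot j k = m + toℕ (combine j k)

  slot-< : ∀ j k → slot j k < D
  slot-< j k = <-≤-trans (+-monoʳ-< m (Fin.toℕ<n (combine j k))) m+m*m≤D

  slot-injective : ∀ {j k j' k'} → slot j k ≡ slot j' k' → j ≡ j' × k ≡ k'
  slot-injective e = Fin.combine-injective _ _ _ _ (Fin.toℕ-injective (+-cancelˡ-≡ m _ _ e))

  retype : Fin N → Fin N → Fin N
  retype p q with typeOf A q ≟τ typeOf A p
  ... | yes _ = q
  ... | no  _ = p

  typeOf-retype : ∀ p q → typeOf A (retype p q) ≡ typeOf A p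
  typeOf-retype p q with typeOf A q ≟τ typeOf A p
  ... | yes same = same
  ... | no  _    = refl

  retype-same : ∀ {p q} → typeOf A q ≡ typeOf A p → retype p q ≡ q
  retype-same {p} {q} same with typeOf A q ≟τ typeOf A p
  ... | yes _     = refl
  ... | no  ¬same = contradiction same ¬same

  profile : Fin N → ℕ → Fin N
  profile p i with Fin.any? (λ j → Fin.any? (λ k → i ≟ slot j k))
  ... | yes (j , k , _) = retype p (witness k (witness j p))
  ... | no  _           = p

  typeOf-profile : ∀ p i → typeOf A (profile p i) ≡ typeOf A p
  typeOf-profile p i with Fin.any? (λ j → Fin.any? (λ k → i ≟ slot j k))
  ... | yes (j , k , _) = typeOf-retype p _
  ... | no  _           = refl

  profile-< : ∀ p {i} → i < m → profile p i ≡ p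
  profile-< p {i} i<m with Fin.any? (λ j → Fin.any? (λ k → i ≟ slot j k))
  ... | yes (j , k , refl) = contradiction i<m (m+n≮m m _)
  ... | no  _              = refl

  profile-slot : ∀ p j k → typeOf A (witness k (witness j p)) ≡ typeOf A p →
    profile p (slot j k) ≡ witness k (witness j p)
  profile-slot p j k same with Fin.any? (λ j' → Fin.any? (λ k' → slot j k ≟ slot j' k'))
  ... | yes (j' , k' , e) with refl , refl ← slot-injective e = retype-same same
  ... | no  none = contradiction (j , k , refl) none

  -- If a = f_j p, the clone of p serving as k-th witness of a is the one whose profile is f_k a, so
  -- that it can play its profile towards a even when a is one of its own witnesses (target-profile).
  target : Fin N → Fin N → Fin m → ℕ
  target p a k with Fin.any? (λ j → witness j p Fin.≟ a)
  ... | yes (j , _) = slot j k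
  ... | no  _       = toℕ k

  target-< : ∀ p a k → target p a k < D
  target-< p a k with Fin.any? (λ j → witness j p Fin.≟ a)
  ... | yes (j , _) = slot-< j k
  ... | no  _       = <-trans (Fin.toℕ<n k) m<D

  target-injective : ∀ p a {k k'} → target p a k ≡ target p a k' → k ≡ k'
  target-injective p a e with Fin.any? (λ j → witness j p Fin.≟ a)
  ... | yes (j , _) = proj₂ (slot-injective e)
  ... | no  _       = Fin.toℕ-injective e

  target-profile : ∀ p i k k' → typeOf A (witness k' (witness k (profile p i))) ≡ typeOf A p →
    target p (witness k (profile p i)) k' ≡ i → witness k' (witness k (profile p i)) ≡ profile p i
  target-profile p i k k' same e with Fin.any? (λ j → witness j p Fin.≟ witness k (profile p i))
  ... | yes (j , wj≡w) = begin
    witness k' (witness k (profile p i))   ≡⟨ cong (witness k') wj≡w ⟨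
    witness k' (witness j p)               ≡⟨ profile-slot p j k' same' ⟨
    profile p (slot j k')                  ≡⟨ cong (profile p) e ⟩
    profile p i                            ∎
    where
    open ≡-Reasoning
    same' = subst (λ z → typeOf A (witness k' z) ≡ typeOf A p) (sym wj≡w) same
  ... | no  none = contradiction (k , cong (witness k) (sym (profile-< p (subst (_< m) e (Fin.toℕ<n k'))))) none

  data Clone : Set where
    kept  : Fin N → Clone
    clone : Fin N → ℕ → Clone

  -- What clone i of p plays towards an element imitating x: f_k x if it serves as the k-th witness of x
  -- (C k), otherwise its profile.
  respond : (p : Fin N) (i : ℕ) (x : Fin N) {C : Fin m → Set} → Decidable C → Fin N
  respond p i x C? with Fin.any? (λ k → (typeOf A (witness k x) ≟τ typeOf A p) ×-dec C? k)
  ... | yes (k , _) = witness k x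
  ... | no  _       = profile p i

  module _ (p : Fin N) (i : ℕ) (x : Fin N) {C : Fin m → Set} (C? : Decidable C) where

    typeOf-respond : typeOf A (respond p i x C?) ≡ typeOf A p
    typeOf-respond with Fin.any? (λ k → (typeOf A (witness k x) ≟τ typeOf A p) ×-dec C? k)
    ... | yes (k , same , _) = same
    ... | no  _              = typeOf-profile p i

    respond-designated : ∀ k → typeOf A (witness k x) ≡ typeOf A p → C k →
      (∀ {k'} → C k' → k' ≡ k) →
      respond p i x C? ≡ witness k x
    respond-designated k same c unique
      with Fin.any? (λ k → (typeOf A (witness k x) ≟τ typeOf A p) ×-dec C? k)
    ... | yes (k' , _ , c') = cong (λ k → witness k x) (unique c')
    ... | no  none          = contradiction (k , same , c) none

    respond-profile : (∀ k → typeOf A (witness k x) ≡ typeOf A p → C k → witness k x ≡ profile p i) →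
      respond p i x C? ≡ profile p i
    respond-profile agree with Fin.any? (λ k → (typeOf A (witness k x) ≟τ typeOf A p) ×-dec C? k)
    ... | yes (k , same , c) = agree k same c
    ... | no  _              = refl

  play : Clone → Clone → Fin N
  play (kept a)    _            = a
  play (clone p i) (kept a)     = respond p i a (λ k → target p a k ≟ i)
  play (clone p i) (clone q i') = respond p i (profile q i') (λ k → i ≟ i' ⊕ suc (toℕ k))

  Realizes : Clone → OneType u b → Set
  Realizes (kept a)    τ = typeOf A a ≡ τ
  Realizes (clone p i) τ = typeOf A p ≡ τ × i < D

  typeOf-play : ∀ {e τ} → Realizes e τ → ∀ e' → typeOf A (play e e') ≡ τ
  typeOf-play {kept a}    same            e'           = same
  typeOf-play {clone p i} (same , _)      (kept a)     = trans (typeOf-respond p i a _) same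
  typeOf-play {clone p i} (same , _)      (clone q i') = trans (typeOf-respond p i (profile q i') _) same

  kept-count : ∀ τ → n τ ≤ D → n' τ ≡ countType A τ
  kept-count τ n≤D = trans (m≤n⇒m⊓n≡m n≤D) (sym (counts τ))

  cloned-count : ∀ τ → ¬ n τ ≤ D → n' τ ≡ D
  cloned-count τ n≰D = m≥n⇒m⊓n≡n (<⇒≤ (≰⇒> n≰D))

  representative : ∀ τ → ¬ n τ ≤ D → Fin N
  representative τ n≰D = element τ (fromℕ< (subst (0 <_) (sym (counts τ)) (≤-<-trans z≤n (≰⇒> n≰D))))

  cloneAt : ∀ τ → Fin (n' τ) → Clone
  cloneAt τ i with n τ ≤? D
  ... | yes n≤D = kept (element τ (cast (kept-count τ n≤D) i))
  ... | no  n≰D = clone (representative τ n≰D) (toℕ i)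

  realizes-cloneAt : ∀ τ i → Realizes (cloneAt τ i) τ
  realizes-cloneAt τ i with n τ ≤? D
  ... | yes n≤D = typeOf-element τ _
  ... | no  n≰D = typeOf-element τ _ , <-≤-trans (Fin.toℕ<n i) (m⊓n≤n (n τ) D)

  cloneAt-kept : ∀ τ → n τ ≤ D → ∀ i j → toℕ i ≡ toℕ j → cloneAt τ i ≡ kept (element τ j)
  cloneAt-kept τ n≤D i j i≡j with n τ ≤? D
  ... | yes _   = cong (kept ∘ element τ) (Fin.toℕ-injective (trans (Fin.toℕ-cast _ i) i≡j))
  ... | no  n≰D = contradiction n≤D n≰D

  cloneAt-clone : ∀ τ (n≰D : ¬ n τ ≤ D) i → cloneAt τ i ≡ clone (representative τ n≰D) (toℕ i)
  cloneAt-clone τ n≰D i with n τ ≤? D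
  ... | yes n≤D = contradiction n≤D n≰D
  ... | no  _   = refl

  asClone : Fin (size n') → Clone
  asClone x = cloneAt (typeAt x) (proj₂ (cell x))

  realizes-asClone : ∀ x → Realizes (asClone x) (typeAt x)
  realizes-asClone x = realizes-cloneAt (typeAt x) (proj₂ (cell x))

  asClone-copy : ∀ τ i → asClone (copy τ i) ≡ cloneAt τ i
  asClone-copy τ i = cong (λ (τ , i) → cloneAt τ i) (cell-copy τ i)

  kept-cell : ∀ w → n (typeOf A w) ≤ D → ∃ λ y → asClone y ≡ kept w
  kept-cell w n≤D = copy σ i , (begin
    asClone (copy σ i)          ≡⟨ asClone-copy σ i ⟩
    cloneAt σ i                 ≡⟨ cloneAt-kept σ n≤D i (indexOf w) (Fin.toℕ-cast _ (indexOf w)) ⟩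
    kept (element σ (indexOf w)) ≡⟨ cong kept (element-indexOf w) ⟩
    kept w                      ∎)
    where
    open ≡-Reasoning
    σ = typeOf A w
    i = cast (sym (kept-count σ n≤D)) (indexOf w)

  clone-cell : ∀ σ (n≰D : ¬ n σ ≤ D) {t} → t < D →
    ∃ λ y → asClone y ≡ clone (representative σ n≰D) t
  clone-cell σ n≰D t<D =
    copy σ i , trans (asClone-copy σ i) (trans (cloneAt-clone σ n≰D i) (cong (clone _) (Fin.toℕ-fromℕ< _)))
    where i = fromℕ< (subst (_ <_) (sym (cloned-count σ n≰D)) t<D)

  WitnessedBy : Fin m → Clone → Set
  WitnessedBy k e = ∃ λ y → biI A (β Γ k) (play e (asClone y)) (play (asClone y) e) ≡ true

  witnessed : ∀ k {e e'} → (∃ λ y → asClone y ≡ e') → biI A (β Γ k) (play e e') (play e' e) ≡ true →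
    WitnessedBy k e
  witnessed k (y , refl) β-holds = y , β-holds

  kept-witnessed : ∀ k a → WitnessedBy k (kept a)
  kept-witnessed k a with n (typeOf A (witness k a)) ≤? D
  ... | yes n≤D = witnessed k (kept-cell (witness k a) n≤D) (witness-β k a)
  ... | no  n≰D = witnessed k (clone-cell σ n≰D (target-< p a k))
      (subst (λ z → biI A (β Γ k) a z ≡ true) (sym designated) (witness-β k a))
    where
    σ = typeOf A (witness k a)
    p = representative σ n≰D
    designated : respond p (target p a k) a (λ k' → target p a k' ≟ target p a k) ≡ witness k a
    designated = respond-designated p _ a _ k (sym (typeOf-element σ _)) refl (target-injective p a)

  clone-witnessed : ∀ k p {i} → i < D → WitnessedBy k (clone p i)
  clone-witnessed k p {i} i<D with n (typeOf A (witness k (profile p i))) ≤? D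
  ... | yes n≤D = witnessed k (kept-cell (witness k (profile p i)) n≤D)
      (subst (λ z → biI A (β Γ k) z (witness k (profile p i)) ≡ true)
             (sym (respond-profile p i _ _ (target-profile p i k))) (witness-β k (profile p i)))
  ... | no  n≰D = witnessed k (clone-cell σ n≰D (⊕-< i<D (<⇒≤ (step<D k))))
      (subst₂ (λ z z' → biI A (β Γ k) z z' ≡ true)
              (sym (respond-profile p i _ _ no-return)) (sym designated) (witness-β k (profile p i)))
    where
    σ = typeOf A (witness k (profile p i))
    q = representative σ n≰D
    t = i ⊕ suc (toℕ k)
    steps<D : ∀ k' → suc (toℕ k) + suc (toℕ k') < D
    steps<D k' = ≤-<-trans (+-mono-≤ (Fin.toℕ<n k) (Fin.toℕ<n k')) 2m<D
    no-return : ∀ k' → typeOf A (witness k' (profile q t)) ≡ typeOf A p → i ≡ t ⊕ suc (toℕ k') →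
      witness k' (profile q t) ≡ profile p i
    no-return k' _ i≡ = contradiction i≡ (⊕-no-round-trip z<s z<s (steps<D k') refl)
    designated : respond q t (profile p i) (λ k' → t ≟ i ⊕ suc (toℕ k')) ≡ witness k (profile p i)
    designated = respond-designated q t _ _ k (sym (typeOf-element σ _)) refl
      (λ t≡ → Fin.toℕ-injective (suc-injective (⊕-cancelˡ i (step<D _) (step<D k) (sym t≡))))

  witnessed-realizing : ∀ k e {τ} → Realizes e τ → WitnessedBy k e
  witnessed-realizing k (kept a)    _         = kept-witnessed k a
  witnessed-realizing k (clone p i) (_ , i<D) = clone-witnessed k p i<D

  simulation : Simulation Γ n' A
  simulation = record
    { play        = λ x y → play (asClone x) (asClone y)
    ; typeOf-play = λ x y → typeOf-play (realizes-asClone x) (asClone y)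
    ; witness     = λ k x → witnessed-realizing k (asClone x) (realizes-asClone x)
    }

shrinking : ∀ {u b m} (Γ : SNF u b m) {n : Config u b} {D : ℕ} → δ m ≤ D →
  Satisfiable Γ n → Satisfiable Γ (λ τ → n τ ⊓ D)
shrinking Γ {D = D} δ≤D (A , A⊨Γ , counts) =
  simulation⇒satisfiable Γ _ (Shrinking.simulation Γ D δ≤D A A⊨Γ counts) (proj₁ A⊨Γ)

⊓-≼ : ∀ {u b} (n : Config u b) {D : ℕ} → D > 0 → (λ τ → n τ ⊓ D) ≼ n
⊓-≼ n {suc d} _ τ = (λ _ → m⊓n≤m (n τ) (suc d)) , vanishes (n τ)
  where
  vanishes : ∀ a → a ⊓ suc d ≡ 0 → a ≡ a ⊓ suc d
  vanishes zero    _ = refl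
  vanishes (suc a) ()

theorem3 : ∀ {u b m} (Γ : SNF u b m) (n : Config u b) →
    Satisfiable Γ n ⇔ Σ (Config u b) (λ n' → Bounded (δ m) n' × Satisfiable Γ n' × (n' ≼ n))
theorem3 {m = m} Γ n = mk⇔
  (λ sat → (λ τ → n τ ⊓ δ m) , (λ τ → m⊓n≤n (n τ) (δ m)) , shrinking Γ ≤-refl sat , ⊓-≼ n (δ>0 m))
  (λ (_ , _ , sat' , n'≼n) → cloning Γ n'≼n sat')
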